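{- Let $q$ be an odd prime power, $\mathbb{F}_q$ the field with $q$ elements, $d\ge1$. Let $h(\mathbf{x})\in\mathbb{F}_q[x_1,\ldots,x_d]$ be a fixed polynomial of degree at most $q-1$ and $b_1,\ldots,b_d$ fixed positive integers with $\gcd(b_j,q-1)=1$ for all $j$. For $\mathbf{a}=(a_1,\ldots,a_{d+1})\in\mathbb{F}_q^{d+1}$ let $$W_{\mathbf{a}}=\{\mathbf{x}\in\mathbb{F}_q^d: h(\mathbf{x})+a_1x_1^{b_1}+\cdots+a_dx_d^{b_d}+a_{d+1}=0\}.$$ Let $\mathcal{P}$ be a set of points in $\mathbb{F}_q^d$ and $\mathcal{S}$ a set of hypersurfaces of the form $W_{\mathbf{a}}$. Then the number of incidences $I(\mathcal{P},\mathcal{S})=|\{(p,s)\in\mathcal{P}\times\mathcal{S}:p\in s\}|$ satisfies $$\left|I(\mathcal{P},\mathcal{S})-\frac{|\mathcal{P}||\mathcal{S}|}{q}\right|\le q^{d/2}\sqrt{|\mathcal{P}||\mathcal{S}|}.$$ -}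

module Defs where

open import Level using (Level; _⊔_) renaming (suc to lsuc)
open import Data.Nat as ℕ using (ℕ; zero; suc; _∸_; _^_; _≤_)
open import Data.Nat.Primality using (Prime)
open import Data.Nat.GCD using (gcd)
open import Data.Integer as ℤ using (ℤ)
open import Data.Fin using (Fin; inject₁; fromℕ)
open import Data.List using (List; []; _∷_; length; filter; cartesianProduct; foldr)
open import Data.List.Relation.Unary.All using (All)
open import Data.List.Relation.Unary.Any using (Any)
open import Data.List.Relation.Unary.AllPairs using (AllPairs)
open import Data.Product using (_×_; _,_; proj₁; proj₂; Σ; ∃)
open import Relation.Nullary using (¬_; Dec)
open import Relation.Binary using (Decidable)
open import Relation.Binary.PropositionalEquality using (_≡_)
open import Algebra.Bundles using (CommutativeRing)

record Field (c ℓ : Level) : Set (lsuc (c ⊔ ℓ)) where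
  field
    commRing : CommutativeRing c ℓ
  open CommutativeRing commRing public
  field
    0≉1     : ¬ (0# ≈ 1#)
    inverse : ∀ x → ¬ (x ≈ 0#) → ∃ λ y → (x * y) ≈ 1#

record FiniteField (c ℓ : Level) (q : ℕ) : Set (lsuc (c ⊔ ℓ)) where
  field
    fld      : Field c ℓ
  open Field fld public
  field
    _≟_      : Decidable _≈_
    elements : List Carrier
    complete : ∀ x → Any (x ≈_) elements
    distinct : AllPairs (λ x y → ¬ (x ≈ y)) elements
    size     : length elements ≡ q

OddPrimePower : ℕ → Set
OddPrimePower q = Σ ℕ λ p → Σ ℕ λ k → Prime p × ¬ (p ≡ 2) × 1 ≤ k × q ≡ p ^ k

module _ {c ℓ : Level} {q : ℕ} (F : FiniteField c ℓ q) where
  open FiniteField F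

  pow : Carrier → ℕ → Carrier
  pow x zero    = 1#
  pow x (suc n) = x * pow x n

  sumℕ : List ℕ → ℕ
  sumℕ = foldr ℕ._+_ 0

  -- A polynomial in d variables, given as a finite list of terms
  -- (coefficient, exponent vector).
  Poly : ℕ → Set c
  Poly d = List (Carrier × (Fin d → ℕ))

  monoDeg : ∀ {d} → (Fin d → ℕ) → ℕ
  monoDeg {zero}  e = 0
  monoDeg {suc d} e = e Fin.zero ℕ.+ monoDeg (λ i → e (Fin.suc i))
    where import Data.Fin as Fin

  monoEval : ∀ {d} → (Fin d → ℕ) → (Fin d → Carrier) → Carrier
  monoEval {zero}  e x = 1#
  monoEval {suc d} e x = pow (x Fin.zero) (e Fin.zero) * monoEval (λ i → e (Fin.suc i)) (λ i → x (Fin.suc i))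
    where import Data.Fin as Fin

  DegreeAtMost : ∀ {d} → Poly d → ℕ → Set c
  DegreeAtMost h m = All (λ t → monoDeg (proj₂ t) ≤ m) h

  evalPoly : ∀ {d} → Poly d → (Fin d → Carrier) → Carrier
  evalPoly []            x = 0#
  evalPoly ((a , e) ∷ h) x = a * monoEval e x + evalPoly h x

  linSum : ∀ {d} → (Fin d → Carrier) → (Fin d → ℕ) → (Fin d → Carrier) → Carrier
  linSum {zero}  a b x = 0#
  linSum {suc d} a b x = a Fin.zero * pow (x Fin.zero) (b Fin.zero)
                         + linSum (λ i → a (Fin.suc i)) (λ i → b (Fin.suc i)) (λ i → x (Fin.suc i))
    where import Data.Fin as Fin

  Wexpr : ∀ {d} → Poly d → (Fin d → ℕ) → (Fin (suc d) → Carrier) → (Fin d → Carrier) → Carrier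
  Wexpr {d} h b a x = evalPoly h x + linSum (λ j → a (inject₁ j)) b x + a (fromℕ d)

  _∈W[_,_]_ : ∀ {d} → (Fin d → Carrier) → Poly d → (Fin d → ℕ) → (Fin (suc d) → Carrier) → Set ℓ
  x ∈W[ h , b ] a = Wexpr h b a x ≈ 0#

  ∈W? : ∀ {d} (h : Poly d) (b : Fin d → ℕ) (a : Fin (suc d) → Carrier) (x : Fin d → Carrier) → Dec (x ∈W[ h , b ] a)
  ∈W? h b a x = Wexpr h b a x ≟ 0#

  _≈ᵛ_ : ∀ {n} → (Fin n → Carrier) → (Fin n → Carrier) → Set ℓ
  u ≈ᵛ v = ∀ i → u i ≈ v i

  IsSetOfVecs : ∀ {n} → List (Fin n → Carrier) → Set (c ⊔ ℓ)
  IsSetOfVecs = AllPairs (λ u v → ¬ (u ≈ᵛ v))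

  incidences : ∀ {d} → Poly d → (Fin d → ℕ) → List (Fin d → Carrier) → List (Fin (suc d) → Carrier) → ℕ
  incidences h b P S = length (filter (λ ps → ∈W? h b (proj₂ ps) (proj₁ ps)) (cartesianProduct P S))

module Submission where

-- For a point x and a parameter a ∈ F^(d+1) let Y_x(a) = q [x ∈ W_a] - 1. Every point lies on q^d of
-- the q^(d+1) hypersurfaces and, since x ↦ x^b is injective when gcd(b, q - 1) = 1, two distinct
-- points lie on exactly q^(d-1) common ones. Hence the functions Y_x are pairwise orthogonal on
-- F^(d+1), each of squared norm q^(d+1) (q - 1). As q I - |P||S| = ∑_{s ∈ S} ∑_{x ∈ P} Y_x(s),
-- Cauchy–Schwarz over S, enlarging the sum of squares from S to all of F^(d+1) and expanding it by
-- orthogonality give (q I - |P||S|)² ≤ |S| |P| q^(d+1) (q - 1) ≤ q^(d+2) |P||S|.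

open import Level using (Level)
open import Function using (_∘_)
open import Data.Empty using (⊥-elim)
open import Data.Product using (_×_; _,_; proj₁; proj₂; ∃)
import Data.Fin as Fin
open import Data.Fin using (Fin)
open import Data.Vec.Functional using (Vector; head; tail; init; last) renaming (_∷_ to _∷ᵛ_)
open import Data.Nat as ℕ using (ℕ; zero; suc; _∸_)
import Data.Nat.Properties as ℕₚ
open import Data.Nat.GCD using (gcd; gcd-GCD; module Bézout)
import Relation.Binary.Reasoning.Setoid
open import Data.Integer using (ℤ; +_; 0ℤ)
import Data.Integer as ℤ
import Data.Integer.Properties as ℤₚ
open import Data.Integer.Tactic.RingSolver using (solve-∀)
open import Data.List using (List; []; _∷_; length; map; _++_; foldr; filter; cartesianProductWith)
open import Algebra.Bundles using (CommutativeMonoid)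
open import Relation.Nullary using (Dec; yes; no; ¬_; ¬?)
open import Function.Bundles using (_⇔_; mk⇔; Equivalence)
open import Relation.Unary using (Pred; Decidable)
open import Relation.Binary.Bundles using (Setoid)
import Relation.Binary.Definitions as Binary
open import Data.List.Relation.Unary.All as All using (All; []; _∷_)
import Data.List.Relation.Unary.All.Properties as All
import Data.List.Relation.Unary.Any.Properties as Any
open import Data.List.Relation.Unary.Any as Any using (Any; here; there; _─_)
open import Data.List.Relation.Unary.AllPairs as AllPairs using ([]; _∷_)
import Data.List.Relation.Unary.AllPairs.Properties as AllPairs
import Relation.Binary.PropositionalEquality as ≡
open ≡ using (_≡_)

open import Defs

module FiniteSum where
  private variable
    a b c p : Level
    A B C : Set a

  open import Data.Integer using (-[1+_]; _+_; _*_; _-_; _≤_; +≤+)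
  open ≡ using (refl; sym; trans; cong; cong₂; subst; module ≡-Reasoning)

  ∑ : List A → (A → ℤ) → ℤ
  ∑ []       f = 0ℤ
  ∑ (x ∷ xs) f = f x + ∑ xs f

  infixl 10 ∑
  syntax ∑ xs (λ x → e) = ∑[ x ← xs ] e

  ∑-cong : ∀ xs {f g : A → ℤ} → (∀ x → f x ≡ g x) → ∑ xs f ≡ ∑ xs g
  ∑-cong []       f≗g = refl
  ∑-cong (x ∷ xs) f≗g = cong₂ _+_ (f≗g x) (∑-cong xs f≗g)

  ∑-+ : ∀ xs (f g : A → ℤ) → ∑[ x ← xs ] (f x + g x) ≡ ∑ xs f + ∑ xs g
  ∑-+ []       f g = refl
  ∑-+ (x ∷ xs) f g rewrite ∑-+ xs f g = interchange (f x) (g x) (∑ xs f) (∑ xs g)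
    where
    interchange : ∀ i j k l → (i + j) + (k + l) ≡ (i + k) + (j + l)
    interchange = solve-∀

  ∑-*ˡ : ∀ xs k (f : A → ℤ) → ∑[ x ← xs ] (k * f x) ≡ k * ∑ xs f
  ∑-*ˡ []       k f = sym (ℤₚ.*-zeroʳ k)
  ∑-*ˡ (x ∷ xs) k f rewrite ∑-*ˡ xs k f = sym (ℤₚ.*-distribˡ-+ k (f x) (∑ xs f))

  ∑-const : ∀ (xs : List A) k → ∑[ x ← xs ] k ≡ + length xs * k
  ∑-const []       k = sym (ℤₚ.*-zeroˡ k)
  ∑-const (x ∷ xs) k rewrite ∑-const xs k = sym (ℤₚ.suc-* (+ length xs) k)

  ∑-++ : ∀ xs ys (f : A → ℤ) → ∑ (xs ++ ys) f ≡ ∑ xs f + ∑ ys f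
  ∑-++ []       ys f = sym (ℤₚ.+-identityˡ (∑ ys f))
  ∑-++ (x ∷ xs) ys f rewrite ∑-++ xs ys f = sym (ℤₚ.+-assoc (f x) (∑ xs f) (∑ ys f))

  ∑-map : ∀ xs (g : A → B) (f : B → ℤ) → ∑ (map g xs) f ≡ ∑[ x ← xs ] f (g x)
  ∑-map []       g f = refl
  ∑-map (x ∷ xs) g f = cong (_+_ (f (g x))) (∑-map xs g f)

  ∑-cartesianProductWith : ∀ (g : A → B → C) xs ys (f : C → ℤ) →
                           ∑ (cartesianProductWith g xs ys) f ≡ ∑[ x ← xs ] ∑[ y ← ys ] f (g x y)
  ∑-cartesianProductWith g []       ys f = refl
  ∑-cartesianProductWith g (x ∷ xs) ys f = begin
    ∑ (map (g x) ys ++ cartesianProductWith g xs ys) f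
      ≡⟨ ∑-++ (map (g x) ys) _ f ⟩
    ∑ (map (g x) ys) f + ∑ (cartesianProductWith g xs ys) f
      ≡⟨ cong₂ _+_ (∑-map ys (g x) f) (∑-cartesianProductWith g xs ys f) ⟩
    ∑[ y ← ys ] f (g x y) + ∑[ x ← xs ] ∑[ y ← ys ] f (g x y) ∎
    where open ≡-Reasoning

  ∑-comm : ∀ xs ys (f : A → B → ℤ) →
           ∑[ x ← xs ] ∑[ y ← ys ] f x y ≡ ∑[ y ← ys ] ∑[ x ← xs ] f x y
  ∑-comm []       ys f = sym (trans (∑-const ys 0ℤ) (ℤₚ.*-zeroʳ (+ length ys)))
  ∑-comm (x ∷ xs) ys f rewrite ∑-comm xs ys f = sym (∑-+ ys (f x) λ y → ∑[ x ← xs ] f x y)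

  ∑-*-∑ : ∀ xs ys (f : A → ℤ) (g : B → ℤ) →
          ∑ xs f * ∑ ys g ≡ ∑[ x ← xs ] ∑[ y ← ys ] (f x * g y)
  ∑-*-∑ []       ys f g = refl
  ∑-*-∑ (x ∷ xs) ys f g = begin
    (f x + ∑ xs f) * ∑ ys g
      ≡⟨ ℤₚ.*-distribʳ-+ (∑ ys g) (f x) (∑ xs f) ⟩
    f x * ∑ ys g + ∑ xs f * ∑ ys g
      ≡⟨ cong₂ _+_ (sym (∑-*ˡ ys (f x) g)) (∑-*-∑ xs ys f g) ⟩
    ∑[ y ← ys ] (f x * g y) + ∑[ x ← xs ] ∑[ y ← ys ] (f x * g y) ∎
    where open ≡-Reasoning

  ∑-affine : ∀ xs k m (f : A → ℤ) → ∑[ x ← xs ] (k * f x - m) ≡ k * ∑ xs f - + length xs * m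
  ∑-affine []       k m f = empty k m
    where
    empty : ∀ k m → 0ℤ ≡ k * 0ℤ - 0ℤ * m
    empty = solve-∀
  ∑-affine (x ∷ xs) k m f rewrite ∑-affine xs k m f = step k m (f x) (∑ xs f) (+ length xs)
    where
    step : ∀ k m y s n → k * y - m + (k * s - n * m) ≡ k * (y + s) - (+ 1 + n) * m
    step = solve-∀

  ∑-affine-product : ∀ xs k m (f g : A → ℤ) →
    ∑[ x ← xs ] ((k * f x - m) * (k * g x - m))
      ≡ k * k * ∑[ x ← xs ] (f x * g x) - k * m * (∑ xs f + ∑ xs g) + m * m * + length xs
  ∑-affine-product []       k m f g = empty k m
    where
    empty : ∀ k m → 0ℤ ≡ k * k * 0ℤ - k * m * (0ℤ + 0ℤ) + m * m * 0ℤ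
    empty = solve-∀
  ∑-affine-product (x ∷ xs) k m f g
    rewrite ∑-affine-product xs k m f g =
      step k m (f x) (g x) (∑[ x ← xs ] (f x * g x)) (∑ xs f) (∑ xs g) (+ length xs)
    where
    step : ∀ k m y z t s r n →
      (k * y - m) * (k * z - m) + (k * k * t - k * m * (s + r) + m * m * n)
        ≡ k * k * (y * z + t) - k * m * ((y + s) + (z + r)) + m * m * (+ 1 + n)
    step = solve-∀

  ∑-zero : ∀ {xs} {f : A → ℤ} → All (λ x → f x ≡ 0ℤ) xs → ∑ xs f ≡ 0ℤ
  ∑-zero []           = refl
  ∑-zero (fx≡0 ∷ f≡0) = cong₂ _+_ fx≡0 (∑-zero f≡0)

  ∑-mono-≤ : ∀ xs {f g : A → ℤ} → (∀ x → f x ≤ g x) → ∑ xs f ≤ ∑ xs g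
  ∑-mono-≤ []       f≤g = ℤₚ.≤-refl
  ∑-mono-≤ (x ∷ xs) f≤g = ℤₚ.+-mono-≤ (f≤g x) (∑-mono-≤ xs f≤g)

  ∑-nonNeg : ∀ xs {f : A → ℤ} → (∀ x → 0ℤ ≤ f x) → 0ℤ ≤ ∑ xs f
  ∑-nonNeg []       0≤f = ℤₚ.≤-refl
  ∑-nonNeg (x ∷ xs) 0≤f = ℤₚ.+-mono-≤ (0≤f x) (∑-nonNeg xs 0≤f)

  i*i≥0 : ∀ i → 0ℤ ≤ i * i
  i*i≥0 (+ n)    rewrite sym (ℤₚ.pos-* n n) = +≤+ ℕ.z≤n
  i*i≥0 -[1+ n ] = +≤+ ℕ.z≤n

  0≤1+n*i⇒0≤i : ∀ n i → 0ℤ ≤ + suc n * i → 0ℤ ≤ i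
  0≤1+n*i⇒0≤i n (+ m)    _  = +≤+ ℕ.z≤n
  0≤1+n*i⇒0≤i n -[1+ m ] ()

  -- The centred sum ∑ (n f x - ∑ f)² equals n (n ∑ f² - (∑ f)²) and is nonnegative.
  cauchy-schwarz : ∀ xs (f : A → ℤ) → ∑ xs f * ∑ xs f ≤ + length xs * ∑[ x ← xs ] (f x * f x)
  cauchy-schwarz []       f = ℤₚ.≤-refl
  cauchy-schwarz xs@(_ ∷ ys) f =
    ℤₚ.0≤i-j⇒j≤i (0≤1+n*i⇒0≤i (length ys) _
      (subst (0ℤ ≤_) centred (∑-nonNeg xs λ x → i*i≥0 (n * f x - s))))
    where
    n = + length xs
    s = ∑ xs f
    t = ∑[ x ← xs ] (f x * f x)
    expand : ∀ n s t → n * n * t - n * s * (s + s) + s * s * n ≡ n * (n * t - s * s)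
    expand = solve-∀
    centred : ∑[ x ← xs ] ((n * f x - s) * (n * f x - s)) ≡ n * (n * t - s * s)
    centred = trans (∑-affine-product xs n s f f) (expand n s t)

  ind : {P : Set p} → Dec P → ℤ
  ind (yes _) = + 1
  ind (no _)  = 0ℤ

  ind-⇔ : ∀ {P : Set p} {Q : Set b} (P? : Dec P) (Q? : Dec Q) → P ⇔ Q → ind P? ≡ ind Q?
  ind-⇔ (yes _)  (yes _)  _   = refl
  ind-⇔ (yes p)  (no ¬q)  P⇔Q = ⊥-elim (¬q (Equivalence.to P⇔Q p))
  ind-⇔ (no ¬p)  (yes q)  P⇔Q = ⊥-elim (¬p (Equivalence.from P⇔Q q))
  ind-⇔ (no _)   (no _)   _   = refl

  ind² : ∀ {P : Set p} (P? : Dec P) → ind P? * ind P? ≡ ind P?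
  ind² (yes _) = refl
  ind² (no _)  = refl

  ind-¬?+ind : ∀ {P : Set p} (P? : Dec P) → ind (¬? P?) + ind P? ≡ + 1
  ind-¬?+ind (yes _) = refl
  ind-¬?+ind (no _)  = refl

  length-filter : ∀ {P : Pred A p} (P? : Decidable P) xs → + length (filter P? xs) ≡ ∑[ x ← xs ] ind (P? x)
  length-filter P? []       = refl
  length-filter P? (x ∷ xs) with P? x
  ... | yes _ = cong (_+_ (+ 1)) (length-filter P? xs)
  ... | no  _ = trans (length-filter P? xs) (sym (ℤₚ.+-identityˡ _))

module UniqueList {a ℓ} (S : Setoid a ℓ) where
  open import Data.Integer using (_+_; _*_; _≤_)
  open Setoid S renaming (Carrier to Elt)
  open import Data.List.Membership.Setoid S using (_∈_)
  open import Data.List.Relation.Unary.Unique.Setoid S using (Unique)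
  open FiniteSum

  private variable
    x y : Elt
    xs ys : List Elt

  ∈-─ : (x∈xs : x ∈ xs) → y ∈ xs → y ≉ Any.lookup x∈xs → y ∈ (xs ─ x∈xs)
  ∈-─ (here _)    (here y≈z)  y≉z = ⊥-elim (y≉z y≈z)
  ∈-─ (here _)    (there y∈)  _   = y∈
  ∈-─ (there _)   (here y≈z)  _   = here y≈z
  ∈-─ (there x∈)  (there y∈)  y≉  = there (∈-─ x∈ y∈ y≉)

  Unique-─ : Unique xs → (x∈xs : x ∈ xs) → Unique (xs ─ x∈xs)
  Unique-─ (_ ∷ u)    (here _)  = u
  Unique-─ (z∉ ∷ u)   (there p) = All.─⁺ p z∉ ∷ Unique-─ u p

  Unique-─-≉ : Unique xs → (x∈xs : x ∈ xs) → All (_≉ Any.lookup x∈xs) (xs ─ x∈xs)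
  Unique-─-≉ (z∉ ∷ _) (here _)  = All.map (_∘ sym) z∉
  Unique-─-≉ (z∉ ∷ u) (there p) = proj₁ (All.lookupAny z∉ p) ∷ Unique-─-≉ u p

  ⊆-─ : ∀ {x} → All (x ≉_) xs → (x∈ys : x ∈ ys) → All (_∈ ys) xs → All (_∈ (ys ─ x∈ys)) xs
  ⊆-─ x∉xs x∈ys xs⊆ys = All.zipWith shift (x∉xs , xs⊆ys)
    where
    shift : ∀ {y} → _ ≉ y × y ∈ _ → y ∈ (_ ─ x∈ys)
    shift (x≉y , y∈ys) = ∈-─ x∈ys y∈ys λ y≈z → x≉y (trans (Any.lookup-result x∈ys) (sym y≈z))

  ⊇-─ : Unique ys → (x∈ys : x ∈ ys) → All (_∈ (x ∷ xs)) ys → All (_∈ xs) (ys ─ x∈ys)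
  ⊇-─ {x = x} u x∈ys ys⊆ = All.zipWith drop (Unique-─-≉ u x∈ys , All.─⁺ x∈ys ys⊆)
    where
    drop : ∀ {y} → y ≉ Any.lookup x∈ys × y ∈ (x ∷ _) → y ∈ _
    drop (y≉z , here y≈x)  = ⊥-elim (y≉z (trans y≈x (Any.lookup-result x∈ys)))
    drop (_   , there y∈xs) = y∈xs

  ∑-─ : ∀ xs (x∈xs : x ∈ xs) (f : Elt → ℤ) → ∑ xs f ≡ f (Any.lookup x∈xs) + ∑ (xs ─ x∈xs) f
  ∑-─ (z ∷ xs) (here _)  f = ≡.refl
  ∑-─ (z ∷ xs) (there p) f rewrite ∑-─ xs p f = +-swap (f z) (f (Any.lookup p)) (∑ (xs ─ p) f)
    where
    +-swap : ∀ i j k → i + (j + k) ≡ j + (i + k)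
    +-swap = solve-∀

  ∑-⊆ : ∀ {g : Elt → ℤ} → (∀ {x y} → x ≈ y → g x ≡ g y) → (∀ x → 0ℤ ≤ g x) →
        Unique xs → All (_∈ ys) xs → ∑ xs g ≤ ∑ ys g
  ∑-⊆ {ys = ys} g-resp 0≤g [] [] = ∑-nonNeg ys 0≤g
  ∑-⊆ {x ∷ xs} {ys} {g} g-resp 0≤g (x∉ ∷ u) (x∈ys ∷ xs⊆ys) = begin
    g x + ∑ xs g
      ≤⟨ ℤₚ.+-monoʳ-≤ (g x) (∑-⊆ g-resp 0≤g u (⊆-─ x∉ x∈ys xs⊆ys)) ⟩
    g x + ∑ (ys ─ x∈ys) g
      ≡⟨ ≡.cong (_+ ∑ (ys ─ x∈ys) g) (g-resp (Any.lookup-result x∈ys)) ⟩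
    g (Any.lookup x∈ys) + ∑ (ys ─ x∈ys) g
      ≡⟨ ∑-─ ys x∈ys g ⟨
    ∑ ys g ∎
    where
    open ℤₚ.≤-Reasoning

  ∑-diagonal : ∀ {G : Elt → Elt → ℤ} → (∀ {x y} → x ≉ y → G x y ≡ 0ℤ) → Unique xs →
               ∑[ x ← xs ] ∑[ y ← xs ] G x y ≡ ∑[ x ← xs ] G x x
  ∑-diagonal G-off [] = ≡.refl
  ∑-diagonal {x ∷ xs} {G} G-off (x∉ ∷ u) = begin
    (G x x + ∑[ y ← xs ] G x y) + ∑[ z ← xs ] (G z x + ∑[ y ← xs ] G z y)
      ≡⟨ ≡.cong₂ _+_ (≡.cong (_+_ (G x x)) row) (∑-+ xs (λ z → G z x) λ z → ∑[ y ← xs ] G z y) ⟩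
    (G x x + 0ℤ) + (∑[ z ← xs ] G z x + ∑[ z ← xs ] ∑[ y ← xs ] G z y)
      ≡⟨ ≡.cong₂ _+_ (ℤₚ.+-identityʳ (G x x)) (≡.cong₂ _+_ column (∑-diagonal G-off u)) ⟩
    G x x + (0ℤ + ∑[ z ← xs ] G z z)
      ≡⟨ ≡.cong (_+_ (G x x)) (ℤₚ.+-identityˡ _) ⟩
    G x x + ∑[ z ← xs ] G z z ∎
    where
    open ≡.≡-Reasoning
    row : ∑[ y ← xs ] G x y ≡ 0ℤ
    row = ∑-zero (All.map G-off x∉)
    column : ∑[ z ← xs ] G z x ≡ 0ℤ
    column = ∑-zero (All.map (λ x≉z → G-off (x≉z ∘ sym)) x∉)

  ∑-select : (_≟_ : Binary.Decidable _≈_) {g : Elt → ℤ} → (∀ {x y} → x ≈ y → g x ≡ g y) →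
             Unique xs → x ∈ xs → ∑[ y ← xs ] (ind (y ≟ x) * g y) ≡ g x
  ∑-select {xs} {x} _≟_ {g} g-resp u x∈xs = begin
    ∑[ y ← xs ] (ind (y ≟ x) * g y)
      ≡⟨ ∑-─ xs x∈xs _ ⟩
    ind (z ≟ x) * g z + ∑[ y ← xs ─ x∈xs ] (ind (y ≟ x) * g y)
      ≡⟨ ≡.cong₂ _+_ selected (∑-zero (All.map unselected (Unique-─-≉ u x∈xs))) ⟩
    g x + 0ℤ
      ≡⟨ ℤₚ.+-identityʳ (g x) ⟩
    g x ∎
    where
    open ≡.≡-Reasoning
    z = Any.lookup x∈xs
    x≈z = Any.lookup-result x∈xs
    selected : ind (z ≟ x) * g z ≡ g x
    selected with z ≟ x
    ... | yes _   = ≡.trans (ℤₚ.*-identityˡ (g z)) (g-resp (sym x≈z))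
    ... | no  z≉x = ⊥-elim (z≉x (sym x≈z))
    unselected : ∀ {y} → y ≉ z → ind (y ≟ x) * g y ≡ 0ℤ
    unselected {y} y≉z with y ≟ x
    ... | yes y≈x = ⊥-elim (y≉z (trans y≈x x≈z))
    ... | no  _   = ≡.refl

  ∑-count : (_≟_ : Binary.Decidable _≈_) → Unique xs → x ∈ xs → ∑[ y ← xs ] ind (y ≟ x) ≡ + 1
  ∑-count {xs} _≟_ u x∈xs =
    ≡.trans (∑-cong xs λ y → ≡.sym (ℤₚ.*-identityʳ _)) (∑-select _≟_ (λ _ → ≡.refl) u x∈xs)

  length-filter-≉ : (_≟_ : Binary.Decidable _≈_) → Unique xs → x ∈ xs →
                    length (filter (λ y → ¬? (y ≟ x)) xs) ℕ.+ 1 ≡ length xs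
  length-filter-≉ {xs} {x} _≟_ u x∈xs = ℤₚ.+-injective (begin
    + length (filter (λ y → ¬? (y ≟ x)) xs) + + 1
      ≡⟨ ≡.cong₂ _+_ (length-filter _ xs) (≡.sym (∑-count _≟_ u x∈xs)) ⟩
    ∑[ y ← xs ] ind (¬? (y ≟ x)) + ∑[ y ← xs ] ind (y ≟ x)
      ≡⟨ ∑-+ xs _ _ ⟨
    ∑[ y ← xs ] (ind (¬? (y ≟ x)) + ind (y ≟ x))
      ≡⟨ ∑-cong xs (λ y → ind-¬?+ind (y ≟ x)) ⟩
    ∑[ y ← xs ] (+ 1)
      ≡⟨ ∑-const xs (+ 1) ⟩
    + length xs * + 1
      ≡⟨ ℤₚ.*-identityʳ _ ⟩
    + length xs ∎)
    where open ≡.≡-Reasoning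

module SameElements {a ℓ} (M : CommutativeMonoid a ℓ) where
  open CommutativeMonoid M renaming (Carrier to Elt)
  open import Algebra.Properties.CommutativeSemigroup commutativeSemigroup using (x∙yz≈y∙xz)
  open import Data.List.Membership.Setoid setoid using (_∈_)
  open import Data.List.Relation.Unary.Unique.Setoid setoid using (Unique)
  open UniqueList setoid using (Unique-─; ⊆-─; ⊇-─)

  private variable
    x : Elt
    xs ys : List Elt

  foldr-─ : ∀ xs (x∈xs : x ∈ xs) → foldr _∙_ ε xs ≈ Any.lookup x∈xs ∙ foldr _∙_ ε (xs ─ x∈xs)
  foldr-─ (z ∷ xs) (here _)  = refl
  foldr-─ (z ∷ xs) (there p) = trans (∙-congˡ (foldr-─ xs p)) (x∙yz≈y∙xz z _ _)

  foldr-sameElements : Unique xs → Unique ys → All (_∈ ys) xs → All (_∈ xs) ys →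
                       foldr _∙_ ε xs ≈ foldr _∙_ ε ys
  foldr-sameElements [] _ [] [] = refl
  foldr-sameElements [] _ [] (() ∷ _)
  foldr-sameElements {ys = ys} (x∉ ∷ uxs) uys (x∈ys ∷ xs⊆ys) ys⊆ =
    trans (∙-cong (Any.lookup-result x∈ys) (foldr-sameElements uxs (Unique-─ uys x∈ys)
                                                                (⊆-─ x∉ x∈ys xs⊆ys) (⊇-─ uys x∈ys ys⊆)))
          (sym (foldr-─ ys x∈ys))

module FieldAlgebra {c ℓ} {q : ℕ} (F : FiniteField c ℓ q) where
  open FiniteField F hiding (zero)
  open import Algebra.Properties.Ring ring
    using (-‿+-comm; ⁻¹-anti-homo‿-; x≈y⇒x∙y⁻¹≈ε; x∙y⁻¹≈ε⇒x≈y; x[y-z]≈xy-xz)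
  open import Algebra.Properties.CommutativeSemigroup +-commutativeSemigroup using (interchange)
  open import Algebra.Properties.Semiring.Exp semiring using (_^_; ^-congˡ; ^-congʳ; ^-homo-*; ^-assocʳ)
  open import Algebra.Properties.CommutativeSemigroup *-commutativeSemigroup
    using () renaming (interchange to *-interchange)
  module ≈-Reasoning = Relation.Binary.Reasoning.Setoid setoid
  open import Data.List.Membership.Setoid setoid using (_∈_)
  open import Data.List.Membership.Setoid.Properties using (∈-filter⁺; ∈-map⁺; ∈-resp-≈)
  open import Data.List.Relation.Unary.Unique.Setoid setoid using (Unique)
  open UniqueList setoid using (length-filter-≉)

  private variable
    x y z u v : Carrier

  module _ (y≉0 : y ≉ 0#) where
    inv : Carrier
    inv = proj₁ (inverse y y≉0)

    private
      inv*y≈1 : inv * y ≈ 1#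
      inv*y≈1 = trans (*-comm inv y) (proj₂ (inverse y y≉0))

    *-cancelˡ-≉0 : y * x ≈ y * z → x ≈ z
    *-cancelˡ-≉0 {x} {z} yx≈yz = begin
      x              ≈⟨ *-identityˡ x ⟨
      1# * x         ≈⟨ *-congʳ inv*y≈1 ⟨
      (inv * y) * x  ≈⟨ *-assoc inv y x ⟩
      inv * (y * x)  ≈⟨ *-congˡ yx≈yz ⟩
      inv * (y * z)  ≈⟨ *-assoc inv y z ⟨
      (inv * y) * z  ≈⟨ *-congʳ inv*y≈1 ⟩
      1# * z         ≈⟨ *-identityˡ z ⟩
      z              ∎
      where open ≈-Reasoning

    ≈-divide : x * y ≈ z → x ≈ z * inv
    ≈-divide {x} {z} xy≈z = *-cancelˡ-≉0 (begin
      y * x          ≈⟨ *-comm y x ⟩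
      x * y          ≈⟨ xy≈z ⟩
      z              ≈⟨ *-identityʳ z ⟨
      z * 1#         ≈⟨ *-congˡ inv*y≈1 ⟨
      z * (inv * y)  ≈⟨ *-assoc z inv y ⟨
      (z * inv) * y  ≈⟨ *-comm (z * inv) y ⟩
      y * (z * inv)  ∎)
      where open ≈-Reasoning

    ≈-multiply : x ≈ z * inv → x * y ≈ z
    ≈-multiply {x} {z} x≈z/y = begin
      x * y          ≈⟨ *-congʳ x≈z/y ⟩
      (z * inv) * y  ≈⟨ *-assoc z inv y ⟩
      z * (inv * y)  ≈⟨ *-congˡ inv*y≈1 ⟩
      z * 1#         ≈⟨ *-identityʳ z ⟩
      z              ∎
      where open ≈-Reasoning

  *-cancelʳ-≉0 : y ≉ 0# → x * y ≈ z * y → x ≈ z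
  *-cancelʳ-≉0 {y} {x} {z} y≉0 xy≈zy = *-cancelˡ-≉0 y≉0 (trans (*-comm y x) (trans xy≈zy (*-comm z y)))

  *-≉0 : x ≉ 0# → y ≉ 0# → x * y ≉ 0#
  *-≉0 {x} {y} x≉0 y≉0 xy≈0 = y≉0 (*-cancelˡ-≉0 x≉0 (trans xy≈0 (sym (zeroʳ x))))

  +-transpose : (u + x) - (v + y) ≈ (x - y) - (v - u)
  +-transpose {u} {x} {v} {y} = begin
    (u + x) - (v + y)       ≈⟨ +-congˡ (-‿+-comm v y) ⟨
    (u + x) + (- v + - y)   ≈⟨ interchange u x (- v) (- y) ⟩
    (u - v) + (x - y)       ≈⟨ +-comm (u - v) (x - y) ⟩
    (x - y) + (u - v)       ≈⟨ +-congˡ (⁻¹-anti-homo‿- v u) ⟨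
    (x - y) - (v - u)       ∎
    where open ≈-Reasoning

  +-≈-transpose : u + x ≈ v + y ⇔ x - y ≈ v - u
  +-≈-transpose = mk⇔
    (λ eq → x∙y⁻¹≈ε⇒x≈y _ _ (trans (sym +-transpose) (x≈y⇒x∙y⁻¹≈ε eq)))
    (λ eq → x∙y⁻¹≈ε⇒x≈y _ _ (trans +-transpose (x≈y⇒x∙y⁻¹≈ε eq)))

  affine-≈ : ∀ {s s' a a' x} (a-a'≉0 : a - a' ≉ 0#) → s + x * a ≈ s' + x * a' ⇔ x ≈ (s' - s) * inv a-a'≉0
  affine-≈ {a = a} {a'} {x} a-a'≉0 = mk⇔
    (λ eq → ≈-divide a-a'≉0 (trans (x[y-z]≈xy-xz x a a') (Equivalence.to +-≈-transpose eq)))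
    (λ eq → Equivalence.from +-≈-transpose (trans (sym (x[y-z]≈xy-xz x a a')) (≈-multiply a-a'≉0 eq)))

  ^≈0⇒≈0 : ∀ n → x ^ n ≈ 0# → x ≈ 0#
  ^≈0⇒≈0 zero    1≈0 = ⊥-elim (0≉1 (sym 1≈0))
  ^≈0⇒≈0 {x} (suc n) xxⁿ≈0 with x ≟ 0#
  ... | yes x≈0 = x≈0
  ... | no  x≉0 = ^≈0⇒≈0 n (*-cancelˡ-≉0 x≉0 (trans xxⁿ≈0 (sym (zeroʳ x))))

  pow≡^ : ∀ x n → pow F x n ≡ x ^ n
  pow≡^ x zero    = ≡.refl
  pow≡^ x (suc n) = ≡.cong (x *_) (pow≡^ x n)

  1^n≈1 : ∀ n → 1# ^ n ≈ 1#
  1^n≈1 zero    = refl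
  1^n≈1 (suc n) = trans (*-identityˡ _) (1^n≈1 n)

  nonzeros : List Carrier
  nonzeros = filter (λ x → ¬? (x ≟ 0#)) elements

  ∈-nonzeros : x ≉ 0# → x ∈ nonzeros
  ∈-nonzeros x≉0 =
    ∈-filter⁺ setoid (λ x → ¬? (x ≟ 0#)) (λ x≈y x≉0 y≈0 → x≉0 (trans x≈y y≈0)) (complete _) x≉0

  nonzeros-≉0 : All (_≉ 0#) nonzeros
  nonzeros-≉0 = All.all-filter (λ x → ¬? (x ≟ 0#)) elements

  Unique-nonzeros : Unique nonzeros
  Unique-nonzeros = AllPairs.filter⁺ (λ x → ¬? (x ≟ 0#)) distinct

  length-nonzeros : length nonzeros ≡ q ∸ 1
  length-nonzeros = ≡.trans (≡.sym (ℕₚ.m+n∸n≡m _ 1))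
    (≡.cong (_∸ 1) (≡.trans (length-filter-≉ _≟_ distinct (complete 0#)) size))

  product : List Carrier → Carrier
  product = foldr _*_ 1#

  product-≉0 : ∀ {xs} → All (_≉ 0#) xs → product xs ≉ 0#
  product-≉0 []           = λ 1≈0 → 0≉1 (sym 1≈0)
  product-≉0 (x≉0 ∷ xs≉0) = *-≉0 x≉0 (product-≉0 xs≉0)

  product-map-* : ∀ x xs → product (map (x *_) xs) ≈ x ^ length xs * product xs
  product-map-* x []       = sym (*-identityˡ 1#)
  product-map-* x (y ∷ xs) = begin
    (x * y) * product (map (x *_) xs)    ≈⟨ *-congˡ (product-map-* x xs) ⟩
    (x * y) * (x ^ length xs * product xs) ≈⟨ *-interchange x y _ _ ⟩
    (x * x ^ length xs) * (y * product xs) ∎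
    where open ≈-Reasoning

  -- Multiplication by x permutes the nonzero elements.
  fermat : x ≉ 0# → x ^ (q ∸ 1) ≈ 1#
  fermat {x} x≉0 = ≡.subst (λ n → x ^ n ≈ 1#) length-nonzeros
    (*-cancelʳ-≉0 (product-≉0 nonzeros-≉0) (begin
      x ^ length nonzeros * product nonzeros  ≈⟨ product-map-* x nonzeros ⟨
      product (map (x *_) nonzeros)           ≈⟨ foldr-sameElements Unique-xN Unique-nonzeros xN⊆N N⊆xN ⟩
      product nonzeros                        ≈⟨ *-identityˡ _ ⟨
      1# * product nonzeros                   ∎))
    where
    open ≈-Reasoning
    open SameElements *-commutativeMonoid using (foldr-sameElements)
    Unique-xN : Unique (map (x *_) nonzeros)
    Unique-xN = AllPairs.map⁺ (AllPairs.map (λ y≉z xy≈xz → y≉z (*-cancelˡ-≉0 x≉0 xy≈xz)) Unique-nonzeros)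
    xN⊆N : All (_∈ nonzeros) (map (x *_) nonzeros)
    xN⊆N = All.map⁺ (All.map (λ y≉0 → ∈-nonzeros (*-≉0 x≉0 y≉0)) nonzeros-≉0)
    x[y/x]≈y : ∀ y → x * (y * inv x≉0) ≈ y
    x[y/x]≈y y = trans (*-comm x _) (≈-multiply x≉0 refl)
    N⊆xN : All (_∈ map (x *_) nonzeros) nonzeros
    N⊆xN = All.map (λ {y} y≉0 → ∈-resp-≈ setoid (x[y/x]≈y y)
                      (∈-map⁺ setoid setoid *-congˡ (∈-nonzeros λ y/x≈0 →
                        y≉0 (trans (sym (x[y/x]≈y y)) (trans (*-congˡ y/x≈0) (zeroʳ x))))))
                   nonzeros-≉0

  ^-periodic : x ≉ 0# → ∀ {m n} v → m ℕ.+ v ℕ.* (q ∸ 1) ≡ n → x ^ n ≈ x ^ m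
  ^-periodic {x} x≉0 {m} v ≡.refl = begin
    x ^ (m ℕ.+ v ℕ.* (q ∸ 1))       ≈⟨ ^-homo-* x m _ ⟩
    x ^ m * x ^ (v ℕ.* (q ∸ 1))     ≡⟨ ≡.cong (λ k → x ^ m * x ^ k) (ℕₚ.*-comm v (q ∸ 1)) ⟩
    x ^ m * x ^ ((q ∸ 1) ℕ.* v)     ≈⟨ *-congˡ (^-assocʳ x (q ∸ 1) v) ⟨
    x ^ m * (x ^ (q ∸ 1)) ^ v       ≈⟨ *-congˡ (trans (^-congˡ v (fermat x≉0)) (1^n≈1 v)) ⟩
    x ^ m * 1#                      ≈⟨ *-identityʳ _ ⟩
    x ^ m                           ∎
    where open ≈-Reasoning

  x≈0∧xᵇ≈yᵇ⇒y≈0 : ∀ {b} → 1 ℕ.≤ b → x ≈ 0# → x ^ b ≈ y ^ b → y ≈ 0#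
  x≈0∧xᵇ≈yᵇ⇒y≈0 {x} {y} {suc b} _ x≈0 xᵇ≈yᵇ =
    ^≈0⇒≈0 (suc b) (trans (sym xᵇ≈yᵇ) (trans (^-congˡ (suc b) x≈0) (zeroˡ _)))

  -- Bézout gives u b ≡ 1 modulo q - 1, so x ↦ x ^ b is inverted by x ↦ x ^ u on nonzero elements.
  ^-injective : ∀ {b} → 1 ℕ.≤ b → gcd b (q ∸ 1) ≡ 1 → x ^ b ≈ y ^ b → x ≈ y
  ^-injective {x} {y} {b} 1≤b gcd≡1 xᵇ≈yᵇ with x ≟ 0# | y ≟ 0#
  ... | yes x≈0 | _       = trans x≈0 (sym (x≈0∧xᵇ≈yᵇ⇒y≈0 1≤b x≈0 xᵇ≈yᵇ))
  ... | no  _   | yes y≈0 = trans (x≈0∧xᵇ≈yᵇ⇒y≈0 1≤b y≈0 (sym xᵇ≈yᵇ)) (sym y≈0)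
  ... | no  x≉0 | no  y≉0 = invert bezout
    where
    bezout : Bézout.Identity 1 b (q ∸ 1)
    bezout = ≡.subst (λ d → Bézout.Identity d b (q ∸ 1)) gcd≡1 (Bézout.identity (gcd-GCD b (q ∸ 1)))
    [zᵇ]ᵘ≈zᵘᵇ : ∀ z u → (z ^ b) ^ u ≈ z ^ (u ℕ.* b)
    [zᵇ]ᵘ≈zᵘᵇ z u = trans (^-assocʳ z b u) (^-congʳ z (ℕₚ.*-comm b u))
    invert : Bézout.Identity 1 b (q ∸ 1) → x ≈ y
    invert (Bézout.+- u v 1+v[q-1]≡ub) = begin
      x              ≈⟨ *-identityʳ x ⟨
      x ^ 1          ≈⟨ ^-periodic x≉0 v 1+v[q-1]≡ub ⟨
      x ^ (u ℕ.* b)  ≈⟨ [zᵇ]ᵘ≈zᵘᵇ x u ⟨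
      (x ^ b) ^ u    ≈⟨ ^-congˡ u xᵇ≈yᵇ ⟩
      (y ^ b) ^ u    ≈⟨ [zᵇ]ᵘ≈zᵘᵇ y u ⟩
      y ^ (u ℕ.* b)  ≈⟨ ^-periodic y≉0 v 1+v[q-1]≡ub ⟩
      y ^ 1          ≈⟨ *-identityʳ y ⟩
      y              ∎
      where open ≈-Reasoning
    invert (Bézout.-+ u v 1+ub≡v[q-1]) =
      *-cancelʳ-≉0 K≉0 (trans (z*K≈1 x≉0) (sym (trans (*-congˡ (^-congˡ u xᵇ≈yᵇ)) (z*K≈1 y≉0))))
      where
      z*K≈1 : ∀ {z} → z ≉ 0# → z * (z ^ b) ^ u ≈ 1#
      z*K≈1 {z} z≉0 = trans (*-congˡ ([zᵇ]ᵘ≈zᵘᵇ z u)) (^-periodic z≉0 v (≡.sym 1+ub≡v[q-1]))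
      K≉0 : (x ^ b) ^ u ≉ 0#
      K≉0 K≈0 = 0≉1 (trans (sym (zeroʳ x)) (trans (*-congˡ (sym K≈0)) (z*K≈1 x≉0)))

module Incidence {c ℓ} {q : ℕ} (F : FiniteField c ℓ q) where
  open FiniteField F hiding (zero)
  open FieldAlgebra F
  open FiniteSum
  open import Algebra.Properties.Ring ring using (-‿injective; +-inverseʳ-unique; x∙y⁻¹≈ε⇒x≈y)
  open import Algebra.Properties.CommutativeSemigroup +-commutativeSemigroup using (x∙yz≈xz∙y)
  open import Data.Vec.Functional.Relation.Binary.Equality.Setoid setoid using (_≋_; ≋-trans)
  open UniqueList setoid using (∑-select; ∑-count)
  open import Data.Fin.Properties using (¬∀⟶∃¬)

  private variable
    n d : ℕ

  infix 7 _·_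
  _·_ : Vector Carrier n → Vector Carrier n → Carrier
  _·_ {zero}  u v = 0#
  _·_ {suc n} u v = head u * head v + tail u · tail v

  ·-congˡ : ∀ {u u' v : Vector Carrier n} → u ≋ u' → u · v ≈ u' · v
  ·-congˡ {zero}  u≋u' = refl
  ·-congˡ {suc n} u≋u' = +-cong (*-congʳ (u≋u' Fin.zero)) (·-congˡ (u≋u' ∘ Fin.suc))

  ind-≟-cong : ∀ {x x' y y'} → x ≈ x' → y ≈ y' → ind (x ≟ y) ≡ ind (x' ≟ y')
  ind-≟-cong x≈x' y≈y' = ind-⇔ _ _ (mk⇔ (λ x≈y → trans (sym x≈x') (trans x≈y y≈y'))
                                   (λ x'≈y' → trans x≈x' (trans x'≈y' (sym y≈y'))))

  ∑-elements-const : ∀ k → ∑[ x ← elements ] k ≡ + q ℤ.* k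
  ∑-elements-const k = ≡.trans (∑-const elements k) (≡.cong (λ m → + m ℤ.* k) size)

  vectors : ∀ n → List (Vector Carrier n)
  vectors zero    = (λ ()) ∷ []
  vectors (suc n) = cartesianProductWith _∷ᵛ_ elements (vectors n)

  ∈-vectors : ∀ n (v : Vector Carrier n) → Any (v ≋_) (vectors n)
  ∈-vectors zero    v = here (λ ())
  ∈-vectors (suc n) v = Any.cartesianProductWith⁺ _∷ᵛ_ cons (complete (head v)) (∈-vectors n (tail v))
    where
    cons : ∀ {x w} → head v ≈ x → tail v ≋ w → v ≋ x ∷ᵛ w
    cons v₀≈x _    Fin.zero    = v₀≈x
    cons _    v'≋w (Fin.suc i) = v'≋w i

  ∑-vectors-const : ∀ n k → ∑[ v ← vectors n ] k ≡ + (q ℕ.^ n) ℤ.* k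
  ∑-vectors-const zero    k = ≡.trans (ℤₚ.+-identityʳ k) (≡.sym (ℤₚ.*-identityˡ k))
  ∑-vectors-const (suc n) k = begin
    ∑[ v ← vectors (suc n) ] k                ≡⟨ ∑-cartesianProductWith _∷ᵛ_ elements (vectors n) _ ⟩
    ∑[ x ← elements ] ∑[ w ← vectors n ] k    ≡⟨ ∑-cong elements (λ _ → ∑-vectors-const n k) ⟩
    ∑[ x ← elements ] (+ (q ℕ.^ n) ℤ.* k)     ≡⟨ ∑-elements-const _ ⟩
    + q ℤ.* (+ (q ℕ.^ n) ℤ.* k)               ≡⟨ ℤₚ.*-assoc (+ q) _ k ⟨
    + q ℤ.* + (q ℕ.^ n) ℤ.* k                 ≡⟨ ≡.cong (ℤ._* k) (ℤₚ.pos-* q _) ⟨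
    + (q ℕ.^ suc n) ℤ.* k                     ∎
    where open ≡.≡-Reasoning

  ∑-root : ∀ {s s' a a'} → a ≉ a' → ∑[ x ← elements ] ind ((s + x * a) ≟ (s' + x * a')) ≡ + 1
  ∑-root {s} {s'} {a} {a'} a≉a' = ≡.trans
    (∑-cong elements λ x → ind-⇔ _ _ (affine-≈ a-a'≉0))
    (∑-count _≟_ distinct (complete _))
    where
    a-a'≉0 : a - a' ≉ 0#
    a-a'≉0 = a≉a' ∘ x∙y⁻¹≈ε⇒x≈y a a'

  -- Whatever the other coordinates of u, exactly one value of u_j solves the equation.
  ∑-linear : ∀ k α β (v v' : Vector Carrier (suc k)) (j : Fin (suc k)) → v j ≉ v' j →
             ∑[ u ← vectors (suc k) ] ind ((α + u · v) ≟ (β + u · v')) ≡ + (q ℕ.^ k)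
  ∑-linear k α β v v' Fin.zero v₀≉v'₀ = begin
    ∑[ u ← vectors (suc k) ] ind ((α + u · v) ≟ (β + u · v'))
      ≡⟨ ∑-cartesianProductWith _∷ᵛ_ elements (vectors k) _ ⟩
    ∑[ x ← elements ] ∑[ w ← vectors k ] ind ((α + (x * v₀ + w · tail v)) ≟ (β + (x * v'₀ + w · tail v')))
      ≡⟨ ∑-comm elements (vectors k) _ ⟩
    ∑[ w ← vectors k ] ∑[ x ← elements ] ind ((α + (x * v₀ + w · tail v)) ≟ (β + (x * v'₀ + w · tail v')))
      ≡⟨ ∑-cong (vectors k) (λ w → ∑-cong elements λ x →
           ind-≟-cong (x∙yz≈xz∙y α _ _) (x∙yz≈xz∙y β _ _)) ⟩
    ∑[ w ← vectors k ] ∑[ x ← elements ] ind (((α + w · tail v) + x * v₀) ≟ ((β + w · tail v') + x * v'₀))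
      ≡⟨ ∑-cong (vectors k) (λ w → ∑-root v₀≉v'₀) ⟩
    ∑[ w ← vectors k ] (+ 1)
      ≡⟨ ∑-vectors-const k (+ 1) ⟩
    + (q ℕ.^ k) ℤ.* + 1
      ≡⟨ ℤₚ.*-identityʳ _ ⟩
    + (q ℕ.^ k) ∎
    where
    open ≡.≡-Reasoning
    v₀ = head v
    v'₀ = head v'
  ∑-linear (suc k) α β v v' (Fin.suc j) vⱼ≉v'ⱼ = begin
    ∑[ u ← vectors (suc (suc k)) ] ind ((α + u · v) ≟ (β + u · v'))
      ≡⟨ ∑-cartesianProductWith _∷ᵛ_ elements (vectors (suc k)) _ ⟩
    ∑[ x ← elements ] ∑[ w ← vectors (suc k) ] ind ((α + (x * v₀ + w · tail v)) ≟ (β + (x * v'₀ + w · tail v')))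
      ≡⟨ ∑-cong elements (λ x → ∑-cong (vectors (suc k)) λ w →
           ind-≟-cong (sym (+-assoc α _ _)) (sym (+-assoc β _ _))) ⟩
    ∑[ x ← elements ] ∑[ w ← vectors (suc k) ] ind (((α + x * v₀) + w · tail v) ≟ ((β + x * v'₀) + w · tail v'))
      ≡⟨ ∑-cong elements (λ x → ∑-linear k (α + x * v₀) (β + x * v'₀) (tail v) (tail v') j vⱼ≉v'ⱼ) ⟩
    ∑[ x ← elements ] (+ (q ℕ.^ k))
      ≡⟨ ∑-elements-const _ ⟩
    + q ℤ.* + (q ℕ.^ k)
      ≡⟨ ℤₚ.pos-* q _ ⟨
    + (q ℕ.^ suc k) ∎
    where
    open ≡.≡-Reasoning
    v₀ = head v
    v'₀ = head v'

  infixl 5 _∷ʳ_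
  _∷ʳ_ : Vector Carrier n → Carrier → Vector Carrier (suc n)
  _∷ʳ_ {zero}  u c = λ _ → c
  _∷ʳ_ {suc n} u c = head u ∷ᵛ (tail u ∷ʳ c)

  init-∷ʳ : ∀ (u : Vector Carrier n) c j → init (u ∷ʳ c) j ≡ u j
  init-∷ʳ {suc n} u c Fin.zero    = ≡.refl
  init-∷ʳ {suc n} u c (Fin.suc j) = init-∷ʳ (tail u) c j

  last-∷ʳ : ∀ (u : Vector Carrier n) c → last (u ∷ʳ c) ≡ c
  last-∷ʳ {zero}  u c = ≡.refl
  last-∷ʳ {suc n} u c = last-∷ʳ (tail u) c

  ∷ʳ-init-last : ∀ (a : Vector Carrier (suc n)) → a ≋ init a ∷ʳ last a
  ∷ʳ-init-last {zero}  a Fin.zero    = refl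
  ∷ʳ-init-last {suc n} a Fin.zero    = refl
  ∷ʳ-init-last {suc n} a (Fin.suc i) = ∷ʳ-init-last (tail a) i

  ∷ʳ-cong : ∀ {u u' : Vector Carrier n} {c c'} → u ≋ u' → c ≈ c' → u ∷ʳ c ≋ u' ∷ʳ c'
  ∷ʳ-cong {zero}  _    c≈c' _           = c≈c'
  ∷ʳ-cong {suc n} u≋u' _    Fin.zero    = u≋u' Fin.zero
  ∷ʳ-cong {suc n} u≋u' c≈c' (Fin.suc i) = ∷ʳ-cong (u≋u' ∘ Fin.suc) c≈c' i

  -- The constant term of W_a is the last coordinate of a, so F^(d+1) is enumerated as u ∷ʳ c.
  parameters : ∀ d → List (Vector Carrier (suc d))
  parameters d = cartesianProductWith _∷ʳ_ (vectors d) elements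

  ∈-parameters : ∀ d (a : Vector Carrier (suc d)) → Any (a ≋_) (parameters d)
  ∈-parameters d a = Any.cartesianProductWith⁺ _∷ʳ_
    (λ init≋u last≈c → ≋-trans (∷ʳ-init-last a) (∷ʳ-cong init≋u last≈c))
    (∈-vectors d (init a)) (complete (last a))

  powers : (Fin d → ℕ) → Vector Carrier d → Vector Carrier d
  powers b x j = pow F (x j) (b j)

  linSum≡· : ∀ (a : Vector Carrier d) b x → linSum F a b x ≡ a · powers b x
  linSum≡· {zero}  a b x = ≡.refl
  linSum≡· {suc d} a b x =
    ≡.cong (_+_ (head a * pow F (head x) (head b))) (linSum≡· (tail a) (tail b) (tail x))

  Wexpr≈· : ∀ (h : Poly F d) b a x → Wexpr F h b a x ≈ (evalPoly F h x + init a · powers b x) + last a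
  Wexpr≈· h b a x = +-congʳ (+-congˡ (reflexive (linSum≡· (init a) b x)))

  Wexpr-cong : ∀ (h : Poly F d) b {a a'} x → a ≋ a' → Wexpr F h b a x ≈ Wexpr F h b a' x
  Wexpr-cong {d} h b {a} {a'} x a≋a' = begin
    Wexpr F h b a x                                       ≈⟨ Wexpr≈· h b a x ⟩
    (evalPoly F h x + init a · powers b x) + last a
      ≈⟨ +-cong (+-congˡ (·-congˡ (a≋a' ∘ Fin.inject₁))) (a≋a' (Fin.fromℕ d)) ⟩
    (evalPoly F h x + init a' · powers b x) + last a'     ≈⟨ Wexpr≈· h b a' x ⟨
    Wexpr F h b a' x                                      ∎
    where open ≈-Reasoning

  offset : Poly F d → (Fin d → ℕ) → Vector Carrier d → Vector Carrier d → Carrier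
  offset h b x u = - (evalPoly F h x + u · powers b x)

  ∈W-∷ʳ : ∀ (h : Poly F d) b x u c → Wexpr F h b (u ∷ʳ c) x ≈ 0# ⇔ c ≈ offset h b x u
  ∈W-∷ʳ h b x u c = mk⇔
    (λ x∈W → +-inverseʳ-unique _ c (trans (sym Wexpr≈) x∈W))
    (λ c≈t → trans Wexpr≈ (trans (+-congˡ c≈t) (-‿inverseʳ _)))
    where
    Wexpr≈ : Wexpr F h b (u ∷ʳ c) x ≈ (evalPoly F h x + u · powers b x) + c
    Wexpr≈ = trans (Wexpr≈· h b (u ∷ʳ c) x)
                   (+-cong (+-congˡ (·-congˡ (reflexive ∘ init-∷ʳ u c))) (reflexive (last-∷ʳ u c)))

  ind-∈W-∷ʳ : ∀ (h : Poly F d) b x u c → ind (∈W? F h b (u ∷ʳ c) x) ≡ ind (c ≟ offset h b x u)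
  ind-∈W-∷ʳ h b x u c = ind-⇔ _ _ (∈W-∷ʳ h b x u c)

  ∑-incident : ∀ (h : Poly F d) b x → ∑[ a ← parameters d ] ind (∈W? F h b a x) ≡ + (q ℕ.^ d)
  ∑-incident {d} h b x = begin
    ∑[ a ← parameters d ] ind (∈W? F h b a x)
      ≡⟨ ∑-cartesianProductWith _∷ʳ_ (vectors d) elements _ ⟩
    ∑[ u ← vectors d ] ∑[ c ← elements ] ind (∈W? F h b (u ∷ʳ c) x)
      ≡⟨ ∑-cong (vectors d) (λ u → ∑-cong elements (ind-∈W-∷ʳ h b x u)) ⟩
    ∑[ u ← vectors d ] ∑[ c ← elements ] ind (c ≟ offset h b x u)
      ≡⟨ ∑-cong (vectors d) (λ u → ∑-count _≟_ distinct (complete _)) ⟩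
    ∑[ u ← vectors d ] (+ 1)
      ≡⟨ ∑-vectors-const d (+ 1) ⟩
    + (q ℕ.^ d) ℤ.* + 1
      ≡⟨ ℤₚ.*-identityʳ _ ⟩
    + (q ℕ.^ d) ∎
    where open ≡.≡-Reasoning

  -- Distinct points differ in some coordinate of powers b, as x ↦ x ^ b is injective.
  ∑-incident-both : ∀ {k} (h : Poly F (suc k)) b → (∀ j → 1 ℕ.≤ b j) → (∀ j → gcd (b j) (q ∸ 1) ≡ 1) →
                    ∀ {x x'} → ¬ x ≋ x' →
                    ∑[ a ← parameters (suc k) ] (ind (∈W? F h b a x) ℤ.* ind (∈W? F h b a x')) ≡ + (q ℕ.^ k)
  ∑-incident-both {k} h b b≥1 gcd≡1 {x} {x'} x≉x' = begin
    ∑[ a ← parameters (suc k) ] (ind (∈W? F h b a x) ℤ.* ind (∈W? F h b a x'))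
      ≡⟨ ∑-cartesianProductWith _∷ʳ_ (vectors (suc k)) elements _ ⟩
    ∑[ u ← vectors (suc k) ] ∑[ c ← elements ] (ind (∈W? F h b (u ∷ʳ c) x) ℤ.* ind (∈W? F h b (u ∷ʳ c) x'))
      ≡⟨ ∑-cong (vectors (suc k)) (λ u → ∑-cong elements λ c →
           ≡.cong₂ ℤ._*_ (ind-∈W-∷ʳ h b x u c) (ind-∈W-∷ʳ h b x' u c)) ⟩
    ∑[ u ← vectors (suc k) ] ∑[ c ← elements ] (ind (c ≟ offset h b x u) ℤ.* ind (c ≟ offset h b x' u))
      ≡⟨ ∑-cong (vectors (suc k)) (λ u →
           ∑-select _≟_ (λ c≈c' → ind-≟-cong c≈c' refl) distinct (complete _)) ⟩
    ∑[ u ← vectors (suc k) ] ind (offset h b x u ≟ offset h b x' u)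
      ≡⟨ ∑-cong (vectors (suc k)) (λ u → ind-⇔ _ _ (mk⇔ -‿injective -‿cong)) ⟩
    ∑[ u ← vectors (suc k) ] ind ((evalPoly F h x + u · powers b x) ≟ (evalPoly F h x' + u · powers b x'))
      ≡⟨ ∑-linear k _ _ (powers b x) (powers b x') j vⱼ≉v'ⱼ ⟩
    + (q ℕ.^ k) ∎
    where
    open ≡.≡-Reasoning
    powers≋⇒≋ : powers b x ≋ powers b x' → x ≋ x'
    powers≋⇒≋ eq j =
      ^-injective (b≥1 j) (gcd≡1 j) (≡.subst₂ _≈_ (pow≡^ (x j) (b j)) (pow≡^ (x' j) (b j)) (eq j))
    difference : ∃ λ j → powers b x j ≉ powers b x' j
    difference = ¬∀⟶∃¬ (suc k) _ (λ j → powers b x j ≟ powers b x' j) (x≉x' ∘ powers≋⇒≋)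
    j = proj₁ difference
    vⱼ≉v'ⱼ = proj₂ difference

  length-parameters : ∀ d → + length (parameters d) ≡ + (q ℕ.^ d) ℤ.* + q
  length-parameters d = begin
    + length (parameters d)                       ≡⟨ ℤₚ.*-identityʳ _ ⟨
    + length (parameters d) ℤ.* + 1               ≡⟨ ∑-const (parameters d) (+ 1) ⟨
    ∑[ a ← parameters d ] (+ 1)                   ≡⟨ ∑-cartesianProductWith _∷ʳ_ (vectors d) elements _ ⟩
    ∑[ u ← vectors d ] ∑[ c ← elements ] (+ 1)    ≡⟨ ∑-cong (vectors d) (λ _ → ∑-elements-const (+ 1)) ⟩
    ∑[ u ← vectors d ] (+ q ℤ.* + 1)              ≡⟨ ∑-vectors-const d _ ⟩
    + (q ℕ.^ d) ℤ.* (+ q ℤ.* + 1)                 ≡⟨ ≡.cong (+ (q ℕ.^ d) ℤ.*_) (ℤₚ.*-identityʳ (+ q)) ⟩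
    + (q ℕ.^ d) ℤ.* + q                           ∎
    where open ≡.≡-Reasoning

module CentredIncidence {c ℓ} {q : ℕ} (F : FiniteField c ℓ q) where
  open FiniteField F using (Carrier; setoid; trans; sym)
  open import Data.Vec.Functional.Relation.Binary.Equality.Setoid setoid using (_≋_; ≋-setoid)
  open import Data.Integer using (_+_; _*_; _-_; _≤_)
  open Incidence F
  open FiniteSum

  module _ {d} (h : Poly F d) (b : Fin d → ℕ) where

    incident : Vector Carrier d → Vector Carrier (suc d) → ℤ
    incident x a = ind (∈W? F h b a x)

    Y : Vector Carrier d → Vector Carrier (suc d) → ℤ
    Y x a = + q * incident x a - + 1

    ∑-Y*Y : ∀ x x' → ∑[ a ← parameters d ] (Y x a * Y x' a)
                     ≡ + q * (+ q * ∑[ a ← parameters d ] (incident x a * incident x' a) - + (q ℕ.^ d))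
    ∑-Y*Y x x' = begin
      ∑[ a ← parameters d ] (Y x a * Y x' a)
        ≡⟨ ∑-affine-product (parameters d) (+ q) (+ 1) _ _ ⟩
      + q * + q * N - + q * + 1 * (∑[ a ← parameters d ] incident x a + ∑[ a ← parameters d ] incident x' a)
        + + 1 * + 1 * + length (parameters d)
        ≡⟨ ≡.cong₂ (λ s n → + q * + q * N - + q * + 1 * s + + 1 * + 1 * n)
             (≡.cong₂ _+_ (∑-incident h b x) (∑-incident h b x')) (length-parameters d) ⟩
      + q * + q * N - + q * + 1 * (Q + Q) + + 1 * + 1 * (Q * + q)
        ≡⟨ factor (+ q) N Q ⟩
      + q * (+ q * N - Q) ∎
      where
      open ≡.≡-Reasoning
      N = ∑[ a ← parameters d ] (incident x a * incident x' a)
      Q = + (q ℕ.^ d)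
      factor : ∀ q N Q → q * q * N - q * + 1 * (Q + Q) + + 1 * + 1 * (Q * q) ≡ q * (q * N - Q)
      factor = solve-∀

    ∑-Y² : ∀ x → ∑[ a ← parameters d ] (Y x a * Y x a) ≤ + (q ℕ.^ (d ℕ.+ 2))
    ∑-Y² x = begin
      ∑[ a ← parameters d ] (Y x a * Y x a)   ≡⟨ ∑-Y*Y x x ⟩
      + q * (+ q * N - Q)                     ≡⟨ ≡.cong (λ n → + q * (+ q * n - Q)) N≡Q ⟩
      + q * (+ q * Q - Q)                     ≤⟨ ℤₚ.*-monoˡ-≤-nonNeg (+ q) (ℤₚ.i-j≤i (+ q * Q) Q) ⟩
      + q * (+ q * Q)                         ≡⟨ q^[d+2] ⟨
      + (q ℕ.^ (d ℕ.+ 2))                     ∎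
      where
      open ℤₚ.≤-Reasoning
      N = ∑[ a ← parameters d ] (incident x a * incident x a)
      Q = + (q ℕ.^ d)
      N≡Q : N ≡ Q
      N≡Q = ≡.trans (∑-cong (parameters d) λ a → ind² (∈W? F h b a x)) (∑-incident h b x)
      q^[d+2] : + (q ℕ.^ (d ℕ.+ 2)) ≡ + q * (+ q * Q)
      q^[d+2] = ≡.trans (≡.cong (λ n → + (q ℕ.^ n)) (ℕₚ.+-comm d 2))
                        (≡.trans (ℤₚ.pos-* q _) (≡.cong (+ q *_) (ℤₚ.pos-* q _)))

  module _ {d} (h : Poly F d) (b : Fin d → ℕ) (P : List (Vector Carrier d)) where

    X : Vector Carrier (suc d) → ℤ
    X a = ∑[ x ← P ] Y h b x a

    X-cong : ∀ {a a'} → a ≋ a' → X a ≡ X a'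
    X-cong a≋a' = ∑-cong P λ x → ≡.cong (λ i → + q * i - + 1)
      (ind-⇔ _ _ (mk⇔ (trans (sym (Wexpr-cong h b x a≋a'))) (trans (Wexpr-cong h b x a≋a'))))

    ∑-X : ∀ S → + q * + incidences F h b P S - + length P * + length S ≡ ∑[ a ← S ] X a
    ∑-X S = ≡.sym (begin
      ∑[ a ← S ] ∑[ x ← P ] (+ q * ind (∈W? F h b a x) - + 1)
        ≡⟨ ∑-comm S P _ ⟩
      ∑[ x ← P ] ∑[ a ← S ] (+ q * ind (∈W? F h b a x) - + 1)
        ≡⟨ ∑-cong P (λ x → ∑-affine S (+ q) (+ 1) _) ⟩
      ∑[ x ← P ] (+ q * ∑[ a ← S ] ind (∈W? F h b a x) - + length S * + 1)
        ≡⟨ ∑-affine P (+ q) _ _ ⟩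
      + q * ∑[ x ← P ] ∑[ a ← S ] ind (∈W? F h b a x) - + length P * (+ length S * + 1)
        ≡⟨ ≡.cong₂ (λ i j → + q * i - + length P * j) (≡.sym incidences≡) (ℤₚ.*-identityʳ _) ⟩
      + q * + incidences F h b P S - + length P * + length S ∎)
      where
      open ≡.≡-Reasoning
      incidences≡ : + incidences F h b P S ≡ ∑[ x ← P ] ∑[ a ← S ] ind (∈W? F h b a x)
      incidences≡ = ≡.trans (length-filter (λ (x , a) → ∈W? F h b a x) (cartesianProductWith _,_ P S))
                            (∑-cartesianProductWith _,_ P S _)

  module _ {k} (h : Poly F (suc k)) (b : Fin (suc k) → ℕ)
           (b≥1 : ∀ j → 1 ℕ.≤ b j) (gcd≡1 : ∀ j → gcd (b j) (q ∸ 1) ≡ 1) where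
    open import Data.List.Relation.Unary.Unique.Setoid (≋-setoid (suc k)) using (Unique)
    open UniqueList (≋-setoid (suc k)) using (∑-diagonal)

    ∑-Y-orthogonal : ∀ {x x'} → ¬ x ≋ x' → ∑[ a ← parameters (suc k) ] (Y h b x a * Y h b x' a) ≡ 0ℤ
    ∑-Y-orthogonal {x} {x'} x≉x' = begin
      ∑[ a ← parameters (suc k) ] (Y h b x a * Y h b x' a)
        ≡⟨ ∑-Y*Y h b x x' ⟩
      + q * (+ q * ∑[ a ← parameters (suc k) ] (incident h b x a * incident h b x' a) - + (q ℕ.^ suc k))
        ≡⟨ ≡.cong₂ (λ n m → + q * (+ q * n - m)) (∑-incident-both h b b≥1 gcd≡1 x≉x') (ℤₚ.pos-* q _) ⟩
      + q * (+ q * + (q ℕ.^ k) - + q * + (q ℕ.^ k))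
        ≡⟨ ≡.cong (+ q *_) (ℤₚ.+-inverseʳ (+ q * + (q ℕ.^ k))) ⟩
      + q * 0ℤ
        ≡⟨ ℤₚ.*-zeroʳ (+ q) ⟩
      0ℤ ∎
      where open ≡.≡-Reasoning

    ∑-X² : ∀ {P} → Unique P → ∑[ a ← parameters (suc k) ] (X h b P a * X h b P a)
                              ≡ ∑[ x ← P ] ∑[ a ← parameters (suc k) ] (Y h b x a * Y h b x a)
    ∑-X² {P} P-unique = begin
      ∑[ a ← params ] (X h b P a * X h b P a)
        ≡⟨ ∑-cong params (λ a → ∑-*-∑ P P _ _) ⟩
      ∑[ a ← params ] ∑[ x ← P ] ∑[ x' ← P ] (Y h b x a * Y h b x' a)
        ≡⟨ ∑-comm params P _ ⟩
      ∑[ x ← P ] ∑[ a ← params ] ∑[ x' ← P ] (Y h b x a * Y h b x' a)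
        ≡⟨ ∑-cong P (λ x → ∑-comm params P _) ⟩
      ∑[ x ← P ] ∑[ x' ← P ] ∑[ a ← params ] (Y h b x a * Y h b x' a)
        ≡⟨ ∑-diagonal ∑-Y-orthogonal P-unique ⟩
      ∑[ x ← P ] ∑[ a ← params ] (Y h b x a * Y h b x a) ∎
      where
      open ≡.≡-Reasoning
      params = parameters (suc k)


open import Data.Nat using (_+_; _^_; _≤_)
open import Data.Integer using (_-_) renaming (_*_ to _*ℤ_; _≤_ to _≤ℤ_)

theorem1p6 : ∀ {c ℓ : Level} (q : ℕ) → OddPrimePower q → (F : FiniteField c ℓ q) →
    (d : ℕ) → 1 ≤ d →
    (h : Poly F d) → DegreeAtMost F h (q ∸ 1) →
    (b : Fin d → ℕ) → (∀ j → 1 ≤ b j) → (∀ j → gcd (b j) (q ∸ 1) ≡ 1) →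
    (P : List (Fin d → FiniteField.Carrier F)) → IsSetOfVecs F P →
    (S : List (Fin (suc d) → FiniteField.Carrier F)) → IsSetOfVecs F S →
    let I  = + incidences F h b P S
        PS = + (length P) *ℤ + (length S)
        e  = (+ q) *ℤ I - PS
    in e *ℤ e ≤ℤ (+ (q ^ (d + 2))) *ℤ PS
theorem1p6 q _ F d@(suc k) _ h _ b b≥1 gcd≡1 P P-unique S S-unique = begin
  e *ℤ e
    ≡⟨ ≡.cong₂ _*ℤ_ (∑-X h b P S) (∑-X h b P S) ⟩
  ∑ S X *ℤ ∑ S X
    ≤⟨ cauchy-schwarz S X ⟩
  nS *ℤ ∑[ a ← S ] (X a *ℤ X a)
    ≤⟨ ℤₚ.*-monoˡ-≤-nonNeg nS S²≤params² ⟩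
  nS *ℤ ∑[ a ← parameters d ] (X a *ℤ X a)
    ≡⟨ ≡.cong (nS *ℤ_) (∑-X² h b b≥1 gcd≡1 P-unique) ⟩
  nS *ℤ ∑[ x ← P ] ∑[ a ← parameters d ] (Y h b x a *ℤ Y h b x a)
    ≤⟨ ℤₚ.*-monoˡ-≤-nonNeg nS (∑-mono-≤ P (∑-Y² h b)) ⟩
  nS *ℤ ∑[ x ← P ] B
    ≡⟨ ≡.cong (nS *ℤ_) (∑-const P B) ⟩
  nS *ℤ (nP *ℤ B)
    ≡⟨ rearrange nS nP B ⟩
  B *ℤ (nP *ℤ nS) ∎
  where
  open ℤₚ.≤-Reasoning
  open FiniteSum
  open Incidence F using (parameters; ∈-parameters)
  open CentredIncidence F using (Y; X-cong; ∑-X; ∑-X²; ∑-Y²)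
  open import Data.Vec.Functional.Relation.Binary.Equality.Setoid (FiniteField.setoid F) using (≋-setoid)
  open UniqueList (≋-setoid (suc d)) using (∑-⊆)
  nP = + length P
  nS = + length S
  B = + (q ^ (d + 2))
  e = + q *ℤ + incidences F h b P S - nP *ℤ nS
  X = CentredIncidence.X F h b P
  S²≤params² : ∑[ a ← S ] (X a *ℤ X a) ≤ℤ ∑[ a ← parameters d ] (X a *ℤ X a)
  S²≤params² = ∑-⊆ (λ a≋a' → ≡.cong₂ _*ℤ_ (X-cong h b P a≋a') (X-cong h b P a≋a'))
                   (λ a → i*i≥0 (X a)) S-unique (All.universal (∈-parameters d) S)
  rearrange : ∀ s p b → s *ℤ (p *ℤ b) ≡ b *ℤ (p *ℤ s)
  rearrange = solve-∀
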